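{- Let $b:F^{\ast}\to T$ be a function such that there is no Weak Dutch Book for $b$. Then $b$ is a partial probability function, i.e. for all formulas $\alpha,\beta\in F^{\ast}$: (A1) $1\models\alpha$ implies $b(\alpha)=(1,0)$; (A2) $b(\alpha\vee\beta)=b(\alpha)+b(\beta)-b(\alpha\wedge\beta)$; (A3) $b(\neg\alpha)=\sigma(b(\alpha))$; (A4) $\mathrm{n}\models\alpha$ implies $(0,0)\preccurlyeq b(\alpha)$.
   Context: Kleene logic: $F^{\ast}$ is the set of formulas built from sentential variables $p_1,\dots,p_m$, the constants $0,1,\mathrm{n}$ and connectives $\neg,\wedge,\vee$. Truth values are encoded as pairs: $K=\{(0,1),(0,0),(1,0)\}$ (false, neutral, true), totally ordered by $(0,1)\prec(0,0)\prec(1,0)$, with $\wedge=\min$, $\vee=\max$, $\neg(1,0)=(0,1)$, $\neg(0,1)=(1,0)$, $\neg(0,0)=(0,0)$. A world is $w\in K^m$; $V_w(p_i)=w_i$, $V_w(0)=(0,1)$, $V_w(1)=(1,0)$, $V_w(\mathrm{n})=(0,0)$, and $V_w$ extends homomorphically to all formulas. Consequence: $\alpha\models\beta$ iff $V_w(\alpha)\le V_w(\beta)$ in the order of $K$ for every world $w\in K^m$. On $\mathbb{R}^2$: $(x,y)\preccurlyeq(w,z)$ iff $x\le w$ and $z\le y$; arithmetic is componentwise (so $(h,k)(a,b)=(ha,kb)$). $T=\{(x,y)\in[0,1]^2:x+y\le 1\}$, $\sigma(x,y)=(y,x)$. Let $\delta=\{(x,x):x\in\mathbb{R}\}$ and $\delta^-=\{(x,y)\in\mathbb{R}^2:x<y\}$.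 A partial bet is a triple $(\alpha,(x,y),(h,k))$ with $\alpha\in F^{\ast}$, $(x,y)\in T$, $(h,k)\in\mathbb{R}^2$; its payoff in world $w$ is $[\alpha,(x,y),(h,k)](w)=(h,k)\,(V_w(\alpha)-(x,y))\in\mathbb{R}^2$. For a finite set $B$ of partial bets, $[B](w)$ is the sum of the payoffs of its members. $B$ is a Dutch Book if $[B](w)\in\delta^-$ for all $w\in K^m$; $B$ is a Weak Dutch Book if $[B](w)\in\delta^-\cup\delta$ for all $w\in K^m$ and $[B](w)\in\delta^-$ for at least one $w$. For $b:F^{\ast}\to T$, a (Weak) Dutch Book for $b$ is a (Weak) Dutch Book all of whose bets have the form $(\alpha_i,b(\alpha_i),(h_i,k_i))$. -}

module Defs where

open import Level using (0ℓ)
open import Data.Nat using (ℕ)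
open import Data.Fin using (Fin)
open import Data.List using (List; []; _∷_)
open import Data.Product using (_×_; _,_; proj₁; proj₂; Σ; ∃)
open import Data.Sum using (_⊎_)
open import Relation.Nullary using (¬_)
open import Relation.Binary.PropositionalEquality using (_≡_)
open import Algebra.Structures using (IsCommutativeRing)
open import Relation.Binary.Structures using (IsStrictTotalOrder)

-- The real numbers, axiomatised as a complete ordered field
-- (ℝ is, up to isomorphism, the unique such structure).

record RealField : Set₁ where
  infixl 6 _+_ _-_
  infixl 7 _*_
  infix 4 _<_ _≤_
  field
    Carrier : Set
    _+_ _*_ : Carrier → Carrier → Carrier
    -_      : Carrier → Carrier
    0ℝ 1ℝ   : Carrier
    _<_     : Carrier → Carrier → Set
    isCommutativeRing  : IsCommutativeRing _≡_ _+_ _*_ -_ 0ℝ 1ℝ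
    isStrictTotalOrder : IsStrictTotalOrder _≡_ _<_
    0<1     : 0ℝ < 1ℝ
    inverse : ∀ x → ¬ (x ≡ 0ℝ) → Σ Carrier λ y → x * y ≡ 1ℝ
    +-mono-< : ∀ {x y} z → x < y → x + z < y + z
    *-pos    : ∀ {x y} → 0ℝ < x → 0ℝ < y → 0ℝ < x * y

  _-_ : Carrier → Carrier → Carrier
  x - y = x + (- y)

  _≤_ : Carrier → Carrier → Set
  x ≤ y = x < y ⊎ x ≡ y

  IsUpperBound : (Carrier → Set) → Carrier → Set
  IsUpperBound P u = ∀ x → P x → x ≤ u

  field
    complete : (P : Carrier → Set) → (∃ λ x → P x) → (∃ λ u → IsUpperBound P u) →
               ∃ λ s → IsUpperBound P s × (∀ u → IsUpperBound P u → s ≤ u)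

data K : Set where
  false neutral true : K

data _≤K_ : K → K → Set where
  f≤ : ∀ {k} → false ≤K k
  n≤n : neutral ≤K neutral
  n≤t : neutral ≤K true
  t≤t : true ≤K true

minK maxK : K → K → K
minK false _ = false
minK neutral false = false
minK neutral _ = neutral
minK true k = k
maxK false k = k
maxK neutral true = true
maxK neutral _ = neutral
maxK true _ = true

negK : K → K
negK false = true
negK neutral = neutral
negK true = false

data Formula (m : ℕ) : Set where
  var   : Fin m → Formula m
  `0 `1 `n : Formula m
  ¬'_   : Formula m → Formula m
  _∧'_ _∨'_ : Formula m → Formula m → Formula m

World : ℕ → Set
World m = Fin m → K

V : ∀ {m} → World m → Formula m → K
V w (var i) = w i
V w `0 = false
V w `1 = true
V w `n = neutral
V w (¬' α) = negK (V w α)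
V w (α ∧' β) = minK (V w α) (V w β)
V w (α ∨' β) = maxK (V w α) (V w β)

_⊨_ : ∀ {m} → Formula m → Formula m → Set
α ⊨ β = ∀ w → V w α ≤K V w β

module _ (R : RealField) where
  open RealField R

  ℝ² : Set
  ℝ² = Carrier × Carrier

  _+²_ _-²_ _·²_ : ℝ² → ℝ² → ℝ²
  (a , b) +² (c , d) = (a + c , b + d)
  (a , b) -² (c , d) = (a - c , b - d)
  (a , b) ·² (c , d) = (a * c , b * d)

  _≼_ : ℝ² → ℝ² → Set
  (x , y) ≼ (w , z) = x ≤ w × z ≤ y

  σ : ℝ² → ℝ² 
  σ (x , y) = (y , x)

  Inδ⁻ : ℝ² → Set
  Inδ⁻ (x , y) = x < y

  Inδ⁻∪δ : ℝ² → Set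
  Inδ⁻∪δ (x , y) = x ≤ y

  record T : Set where
    constructor mkT
    field
      pt    : ℝ²
      fst≥0 : 0ℝ ≤ proj₁ pt
      snd≥0 : 0ℝ ≤ proj₂ pt
      sum≤1 : proj₁ pt + proj₂ pt ≤ 1ℝ
  open T public

  enc : K → ℝ²
  enc false   = (0ℝ , 1ℝ)
  enc neutral = (0ℝ , 0ℝ)
  enc true    = (1ℝ , 0ℝ)

  record Bet (m : ℕ) : Set where
    constructor bet
    field
      formula : Formula m
      price   : T
      stake   : ℝ²

  payoff : ∀ {m} → Bet m → World m → ℝ²
  payoff (bet α xy hk) w = hk ·² (enc (V w α) -² pt xy)

  totalPayoff : ∀ {m} → List (Bet m) → World m → ℝ²
  totalPayoff [] w = (0ℝ , 0ℝ)
  totalPayoff (β ∷ B) w = payoff β w +² totalPayoff B w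

  IsWeakDutchBook : ∀ {m} → List (Bet m) → Set
  IsWeakDutchBook B = (∀ w → Inδ⁻∪δ (totalPayoff B w)) × (∃ λ w → Inδ⁻ (totalPayoff B w))

  data BetsFor {m : ℕ} (b : Formula m → T) : List (Bet m) → Set where
    []  : BetsFor b []
    _∷_ : ∀ {α hk B} → BetsFor b B → BetsFor b (bet α (b α) hk ∷ B)

  WeakDutchBookFor : ∀ {m} → (Formula m → T) → Set
  WeakDutchBookFor b = ∃ λ B → BetsFor b B × IsWeakDutchBook B

  IsPartialProbability : ∀ {m} → (Formula m → T) → Set
  IsPartialProbability {m} b =
    (∀ α → `1 ⊨ α → pt (b α) ≡ (1ℝ , 0ℝ)) ×
    (∀ α β → pt (b (α ∨' β)) ≡ (pt (b α) +² pt (b β)) -² pt (b (α ∧' β))) ×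
    (∀ α → pt (b (¬' α)) ≡ σ (pt (b α))) ×
    (∀ α → `n ⊨ α → (0ℝ , 0ℝ) ≼ pt (b α))

-- Call the margin of a book in a world the first minus the second coordinate of
-- its total payoff.  A book with the same negative margin in every world is a
-- Dutch Book, and negating every stake negates the margin, so under coherence a
-- book of constant margin has margin 0.  Buying one portfolio of unit bets and
-- selling another of the same value in every world yields such a book, hence
-- coherent prices obey the law of one price.  Each of (A1)–(A4) is an instance:
-- α ∨ β and α ∧ β take the values of α and β in some order, ¬ α has the
-- coordinates of α swapped, and a formula entailed by 1 (resp. n) has a constant
-- first (resp. second) coordinate.
module Submission where

open import Defs
open import Data.Nat using (ℕ)
open import Data.List using (List; []; _∷_; [_]; _++_; map)
open import Data.Product using (_×_; _,_; proj₁; proj₂)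
open import Data.Sum using (inj₁; inj₂)
open import Relation.Nullary using (¬_; contradiction)
open import Relation.Binary.PropositionalEquality using (_≡_; refl; sym; trans; cong; cong₂; subst; subst₂; module ≡-Reasoning)
open import Relation.Binary.Definitions using (tri<; tri≈; tri>)
open import Relation.Binary.Structures using (IsStrictTotalOrder)
open import Algebra.Bundles using (CommutativeRing)

module _ (R : RealField) where

  open RealField R using (Carrier; _<_; +-mono-<; isCommutativeRing; isStrictTotalOrder)

  commutativeRing : CommutativeRing _ _
  commutativeRing = record { isCommutativeRing = isCommutativeRing }

  open CommutativeRing commutativeRing hiding (refl; sym; trans; Carrier; isCommutativeRing)
  open import Algebra.Properties.Ring ring
    using (-1*x≈-x; -‿distribˡ-*; -0#≈0#; -‿involutive; -‿+-comm; ⁻¹-anti-homo‿-;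
           x∙y⁻¹≈ε⇒x≈y; \\-leftDividesʳ; //-rightDividesˡ; //-rightDividesʳ; +-cancelʳ)
  open import Algebra.Properties.CommutativeSemigroup +-commutativeSemigroup
    using (interchange)
  open IsStrictTotalOrder isStrictTotalOrder using (compare)
  open ≡-Reasoning

  x-y<0⇒x<y : ∀ {x y} → x - y < 0# → x < y
  x-y<0⇒x<y {x} {y} x-y<0 =
    subst₂ _<_ (//-rightDividesˡ y x) (+-identityˡ y) (+-mono-< y x-y<0)

  0<x⇒-x<0 : ∀ {x} → 0# < x → - x < 0#
  0<x⇒-x<0 {x} 0<x = subst₂ _<_ (+-identityˡ (- x)) (-‿inverseʳ x) (+-mono-< (- x) 0<x)

  x≮0∧-x≮0⇒x≡0 : ∀ {x} → ¬ x < 0# → ¬ - x < 0# → x ≡ 0#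
  x≮0∧-x≮0⇒x≡0 {x} x≮0 -x≮0 with compare x 0#
  ... | tri< x<0 _ _ = contradiction x<0 x≮0
  ... | tri≈ _ x≡0 _ = x≡0
  ... | tri> _ _ 0<x = contradiction (0<x⇒-x<0 0<x) -x≮0

  [x+y]-[u+v]≡[x-u]+[y-v] : ∀ x y u v → (x + y) - (u + v) ≡ (x - u) + (y - v)
  [x+y]-[u+v]≡[x-u]+[y-v] x y u v = begin
    (x + y) + - (u + v)     ≡⟨ cong ((x + y) +_) (sym (-‿+-comm u v)) ⟩
    (x + y) + (- u + - v)   ≡⟨ interchange x y (- u) (- v) ⟩
    (x - u) + (y - v)       ∎

  [v-p]-[v-q]≡q-p : ∀ v p q → (v - p) - (v - q) ≡ q - p
  [v-p]-[v-q]≡q-p v p q = begin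
    (v - p) + - (v - q)    ≡⟨ cong ((v - p) +_) (⁻¹-anti-homo‿- v q) ⟩
    (v - p) + (q - v)      ≡⟨ +-comm (v - p) (q - v) ⟩
    (q - v) + (v - p)      ≡⟨ +-assoc q (- v) (v - p) ⟩
    q + (- v + (v - p))    ≡⟨ cong (q +_) (\\-leftDividesʳ v (- p)) ⟩
    q - p                  ∎

  max+min≡+ : ∀ (f : K → Carrier) u v → f (maxK u v) + f (minK u v) ≡ f u + f v
  max+min≡+ f false   neutral = +-comm (f neutral) (f false)
  max+min≡+ f false   true    = +-comm (f true) (f false)
  max+min≡+ f neutral true    = +-comm (f true) (f neutral)
  max+min≡+ f false   false   = refl
  max+min≡+ f neutral false   = refl
  max+min≡+ f neutral neutral = refl
  max+min≡+ f true    _       = refl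

  data Coordinate : Set where
    ι₁ ι₂ : Coordinate

  π : Coordinate → ℝ² R → Carrier
  π ι₁ = proj₁
  π ι₂ = proj₂

  swap : Coordinate → Coordinate
  swap ι₁ = ι₂
  swap ι₂ = ι₁

  π-swap-negK : ∀ i k → π (swap i) (enc R (negK k)) ≡ π i (enc R k)
  π-swap-negK ι₁ false   = refl
  π-swap-negK ι₁ neutral = refl
  π-swap-negK ι₁ true    = refl
  π-swap-negK ι₂ false   = refl
  π-swap-negK ι₂ neutral = refl
  π-swap-negK ι₂ true    = refl

  true≤K⇒≡true : ∀ {k} → true ≤K k → k ≡ true
  true≤K⇒≡true t≤t = refl

  neutral≤K⇒π₂≡0 : ∀ {k} → neutral ≤K k → π ι₂ (enc R k) ≡ 0#
  neutral≤K⇒π₂≡0 n≤n = refl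
  neutral≤K⇒π₂≡0 n≤t = refl

  -- A bet is lost by the bettor when the first coordinate of its payoff falls
  -- below the second, so a unit stake on the second coordinate is -1.
  unitStake : Coordinate → ℝ² R
  unitStake ι₁ = (1# , 0#)
  unitStake ι₂ = (0# , - 1#)

  module _ {m : ℕ} where

    betMargin : Bet R m → World m → Carrier
    betMargin β w = proj₁ (payoff R β w) - proj₂ (payoff R β w)

    margin : List (Bet R m) → World m → Carrier
    margin B w = proj₁ (totalPayoff R B w) - proj₂ (totalPayoff R B w)

    margin-∷ : ∀ β B w → margin (β ∷ B) w ≡ betMargin β w + margin B w
    margin-∷ β B w = [x+y]-[u+v]≡[x-u]+[y-v] _ _ _ _

    margin-[] : ∀ w → margin [] w ≡ 0#
    margin-[] w = -‿inverseʳ 0#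

    margin-++ : ∀ B C w → margin (B ++ C) w ≡ margin B w + margin C w
    margin-++ [] C w = begin
      margin C w                ≡⟨ sym (+-identityˡ (margin C w)) ⟩
      0# + margin C w           ≡⟨ cong (_+ margin C w) (sym (margin-[] w)) ⟩
      margin [] w + margin C w  ∎
    margin-++ (β ∷ B) C w = begin
      margin (β ∷ B ++ C) w                      ≡⟨ margin-∷ β (B ++ C) w ⟩
      betMargin β w + margin (B ++ C) w          ≡⟨ cong (betMargin β w +_) (margin-++ B C w) ⟩
      betMargin β w + (margin B w + margin C w)  ≡⟨ sym (+-assoc _ _ _) ⟩
      (betMargin β w + margin B w) + margin C w  ≡⟨ cong (_+ margin C w) (sym (margin-∷ β B w)) ⟩
      margin (β ∷ B) w + margin C w              ∎

    counter : Bet R m → Bet R m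
    counter (bet α p (h , k)) = bet α p (- h , - k)

    betMargin-counter : ∀ β w → betMargin (counter β) w ≡ - betMargin β w
    betMargin-counter (bet α p (h , k)) w = begin
      (- h) * a - (- k) * c        ≡⟨ cong₂ _-_ (sym (-‿distribˡ-* h a)) (sym (-‿distribˡ-* k c)) ⟩
      - (h * a) + - - (k * c)      ≡⟨ -‿+-comm (h * a) (- (k * c)) ⟩
      - (h * a - k * c)            ∎
      where
      a = proj₁ (enc R (V w α)) - proj₁ (pt p)
      c = proj₂ (enc R (V w α)) - proj₂ (pt p)

    margin-counter : ∀ B w → margin (map counter B) w ≡ - margin B w
    margin-counter [] w = sym (⁻¹-anti-homo‿- 0# 0#)
    margin-counter (β ∷ B) w = begin
      margin (counter β ∷ map counter B) w                ≡⟨ margin-∷ (counter β) (map counter B) w ⟩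
      betMargin (counter β) w + margin (map counter B) w  ≡⟨ cong₂ _+_ (betMargin-counter β w) (margin-counter B w) ⟩
      - betMargin β w + - margin B w                      ≡⟨ -‿+-comm (betMargin β w) (margin B w) ⟩
      - (betMargin β w + margin B w)                      ≡⟨ cong -_ (sym (margin-∷ β B w)) ⟩
      - margin (β ∷ B) w                                  ∎

    betMargin-unitStake : ∀ i α p w →
      betMargin (bet α p (unitStake i)) w ≡ π i (enc R (V w α)) - π i (pt p)
    betMargin-unitStake ι₁ α p w = begin
      1# * a - 0# * c  ≡⟨ cong₂ _-_ (*-identityˡ a) (zeroˡ c) ⟩
      a - 0#           ≡⟨ cong (a +_) -0#≈0# ⟩
      a + 0#           ≡⟨ +-identityʳ a ⟩
      a                ∎
      where
      a = proj₁ (enc R (V w α)) - proj₁ (pt p)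
      c = proj₂ (enc R (V w α)) - proj₂ (pt p)
    betMargin-unitStake ι₂ α p w = begin
      0# * a - (- 1#) * c  ≡⟨ cong₂ _-_ (zeroˡ a) (-1*x≈-x c) ⟩
      0# - - c             ≡⟨ +-identityˡ (- - c) ⟩
      - - c                ≡⟨ -‿involutive c ⟩
      c                    ∎
      where
      a = proj₁ (enc R (V w α)) - proj₁ (pt p)
      c = proj₂ (enc R (V w α)) - proj₂ (pt p)

    constant-negative-margin⇒WeakDutchBook :
      ∀ {B c} → (∀ w → margin B w ≡ c) → c < 0# → IsWeakDutchBook R B
    constant-negative-margin⇒WeakDutchBook {B} {c} constant c<0 =
      (λ w → inj₁ (loses w)) , (λ _ → false) , loses (λ _ → false)
      where
      loses : ∀ w → proj₁ (totalPayoff R B w) < proj₂ (totalPayoff R B w)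
      loses w = x-y<0⇒x<y (subst (_< 0#) (sym (constant w)) c<0)

    Position : Set
    Position = Coordinate × Formula m

    value : List Position → World m → Carrier
    value []            w = 0#
    value ((i , α) ∷ P) w = π i (enc R (V w α)) + value P w

    module _ (b : Formula m → T R) where

      price : List Position → Carrier
      price []            = 0#
      price ((i , α) ∷ P) = π i (pt (b α)) + price P

      buy : List Position → List (Bet R m)
      buy []            = []
      buy ((i , α) ∷ P) = bet α (b α) (unitStake i) ∷ buy P

      betsFor-buy : ∀ P → BetsFor R b (buy P)
      betsFor-buy []            = []
      betsFor-buy ((i , α) ∷ P) = _∷_ (betsFor-buy P)

      betsFor-counter : ∀ {B} → BetsFor R b B → BetsFor R b (map counter B)
      betsFor-counter []          = []
      betsFor-counter (_∷_ bets) = _∷_ (betsFor-counter bets)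

      betsFor-++ : ∀ {B C} → BetsFor R b B → BetsFor R b C → BetsFor R b (B ++ C)
      betsFor-++ []          betsC = betsC
      betsFor-++ (_∷_ betsB) betsC = _∷_ (betsFor-++ betsB betsC)

      margin-buy : ∀ P w → margin (buy P) w ≡ value P w - price P
      margin-buy []            w = refl
      margin-buy ((i , α) ∷ P) w = begin
        margin (buy ((i , α) ∷ P)) w
          ≡⟨ margin-∷ (bet α (b α) (unitStake i)) (buy P) w ⟩
        betMargin (bet α (b α) (unitStake i)) w + margin (buy P) w
          ≡⟨ cong₂ _+_ (betMargin-unitStake i α (b α) w) (margin-buy P w) ⟩
        (π i (enc R (V w α)) - π i (pt (b α))) + (value P w - price P)
          ≡⟨ sym ([x+y]-[u+v]≡[x-u]+[y-v] _ _ _ _) ⟩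
        value ((i , α) ∷ P) w - price ((i , α) ∷ P)
          ∎

      module Coherent (coherent : ¬ WeakDutchBookFor R b) where

        constant-margin⇒≡0 : ∀ {B c} → BetsFor R b B → (∀ w → margin B w ≡ c) → c ≡ 0#
        constant-margin⇒≡0 {B} {c} bets constant = x≮0∧-x≮0⇒x≡0
          (λ c<0 → coherent (B , bets ,
            constant-negative-margin⇒WeakDutchBook {B} constant c<0))
          (λ -c<0 → coherent (map counter B , betsFor-counter bets ,
            constant-negative-margin⇒WeakDutchBook {map counter B}
              (λ w → trans (margin-counter B w) (cong -_ (constant w))) -c<0))

        price-riskless : ∀ P {c} → (∀ w → value P w ≡ c) → price P ≡ c
        price-riskless P {c} riskless = sym (x∙y⁻¹≈ε⇒x≈y c (price P)
          (constant-margin⇒≡0 (betsFor-buy P)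
            (λ w → trans (margin-buy P w) (cong (_- price P) (riskless w)))))

        law-of-one-price : ∀ P S → (∀ w → value P w ≡ value S w) → price P ≡ price S
        law-of-one-price P S sameValue = sym (x∙y⁻¹≈ε⇒x≈y (price S) (price P)
          (constant-margin⇒≡0 (betsFor-++ (betsFor-buy P) (betsFor-counter (betsFor-buy S)))
            constantMargin))
          where
          constantMargin : ∀ w → margin (buy P ++ map counter (buy S)) w ≡ price S - price P
          constantMargin w = begin
            margin (buy P ++ map counter (buy S)) w
              ≡⟨ margin-++ (buy P) _ w ⟩
            margin (buy P) w + margin (map counter (buy S)) w
              ≡⟨ cong₂ _+_ (margin-buy P w) (margin-counter (buy S) w) ⟩
            (value P w - price P) - margin (buy S) w
              ≡⟨ cong₂ (λ x y → (x - price P) - y) (sameValue w) (margin-buy S w) ⟩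
            (value S w - price P) - (value S w - price S)
              ≡⟨ [v-p]-[v-q]≡q-p (value S w) (price P) (price S) ⟩
            price S - price P
              ∎

        1⊨⇒price≡true : ∀ α → `1 ⊨ α → pt (b α) ≡ (1# , 0#)
        1⊨⇒price≡true α 1⊨α = cong₂ _,_ (coordinate ι₁) (coordinate ι₂)
          where
          coordinate : ∀ i → π i (pt (b α)) ≡ π i (enc R true)
          coordinate i = +-cancelʳ 0# _ _ (price-riskless [ i , α ]
            (λ w → cong (λ k → π i (enc R k) + 0#) (true≤K⇒≡true (1⊨α w))))

        price-∨ : ∀ α β → pt (b (α ∨' β)) ≡ _-²_ R (_+²_ R (pt (b α)) (pt (b β))) (pt (b (α ∧' β)))
        price-∨ α β = cong₂ _,_ (coordinate ι₁) (coordinate ι₂)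
          where
          pad : ∀ {x y u v} → x + y ≡ u + v → x + (y + 0#) ≡ u + (v + 0#)
          pad {x} {y} {u} {v} eq =
            trans (sym (+-assoc x y 0#)) (trans (cong (_+ 0#) eq) (+-assoc u v 0#))
          unpad : ∀ {x y u v} → x + (y + 0#) ≡ u + (v + 0#) → x + y ≡ u + v
          unpad {x} {y} {u} {v} eq =
            +-cancelʳ 0# _ _ (trans (+-assoc x y 0#) (trans eq (sym (+-assoc u v 0#))))
          coordinate : ∀ i → π i (pt (b (α ∨' β))) ≡
            (π i (pt (b α)) + π i (pt (b β))) - π i (pt (b (α ∧' β)))
          coordinate i = begin
            x∨                     ≡⟨ sym (//-rightDividesʳ x∧ x∨) ⟩
            (x∨ + x∧) - x∧         ≡⟨ cong (_- x∧) (unpad (law-of-one-price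
                                        ((i , α ∨' β) ∷ [ i , α ∧' β ]) ((i , α) ∷ [ i , β ])
                                        (λ w → pad (max+min≡+ (λ k → π i (enc R k)) (V w α) (V w β))))) ⟩
            (xα + xβ) - x∧         ∎
            where
            x∨ = π i (pt (b (α ∨' β)))
            x∧ = π i (pt (b (α ∧' β)))
            xα = π i (pt (b α))
            xβ = π i (pt (b β))

        price-¬ : ∀ α → pt (b (¬' α)) ≡ σ R (pt (b α))
        price-¬ α = cong₂ _,_ (coordinate ι₂) (coordinate ι₁)
          where
          coordinate : ∀ i → π (swap i) (pt (b (¬' α))) ≡ π i (pt (b α))
          coordinate i = +-cancelʳ 0# _ _ (law-of-one-price [ swap i , ¬' α ] [ i , α ]
            (λ w → cong (_+ 0#) (π-swap-negK i (V w α))))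

        n⊨⇒0≼price : ∀ α → `n ⊨ α → _≼_ R (0# , 0#) (pt (b α))
        n⊨⇒0≼price α n⊨α = fst≥0 (b α) , inj₂ (+-cancelʳ 0# _ _ (price-riskless [ ι₂ , α ]
          (λ w → cong (_+ 0#) (neutral≤K⇒π₂≡0 (n⊨α w)))))

mainTheorem3 : (R : RealField) (m : ℕ) (b : Formula m → T R) →
    ¬ WeakDutchBookFor R b → IsPartialProbability R b
mainTheorem3 R m b coherent = 1⊨⇒price≡true , price-∨ , price-¬ , n⊨⇒0≼price
  where open Coherent R b coherent
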